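{- Let $k\ge 2$ and $R=F_{q_1}\times\cdots\times F_{q_k}$, where $F_q$ is a finite field with $q$ elements. Let $\mathcal P$ be the set of non-empty proper subsets of $[k]$, let $D_1$ be the set of unordered pairs $\{A,B\}$ of distinct elements of $\mathcal P$ with $A\not\subseteq B$ and $B\not\subseteq A$, and let $D_2$ be the set of pairs $\{A,B\}$ of elements of $\mathcal P$ with $A\subsetneq B$. Then the Wiener index of the cozero-divisor graph of $R$ is \[ W(\Gamma'(R)) = 2\sum_{A\in\mathcal P}\binom{\prod_{i\in A}(q_i-1)}{2} + \sum_{\{A,B\}\in D_1}\Big(\prod_{i\in A}(q_i-1)\Big)\Big(\prod_{j\in B}(q_j-1)\Big) + 2\sum_{\{A,B\}\in D_2}\Big(\prod_{i\in A}(q_i-1)\Big)\Big(\prod_{j\in B}(q_j-1)\Big). \]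
   Context: The cozero-divisor graph $\Gamma'(R)$ of a ring $R$ with unity is the simple undirected graph whose vertices are the non-zero non-unit elements of $R$, with distinct vertices $x,y$ adjacent iff $x\notin Ry$ and $y\notin Rx$. The Wiener index of a connected graph is the sum of shortest-path distances over all unordered pairs of distinct vertices. $[k]=\{1,\dots,k\}$. -}

module Defs where

open import Level using (Level; _⊔_; suc)
open import Data.Nat as ℕ using (ℕ; zero; _∸_)
open import Data.Nat.Combinatorics using (_C_)
open import Data.Bool using (Bool; true; false; if_then_else_)
open import Data.Fin using (Fin)
open import Data.Fin.Subset using (Subset; _⊆_; Nonempty; ∁; _∈_)
open import Data.Fin.Subset.Properties using (_⊆?_; nonempty?)
open import Data.Vec as Vec using (Vec; []; _∷_; lookup)
open import Data.List as List using (List; []; _∷_; map; filter; allFin; concatMap)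
open import Data.Nat.ListAction using (sum; product)
open import Data.List.Relation.Unary.Any using (Any)
open import Data.List.Relation.Unary.AllPairs using (AllPairs)
open import Data.Product using (Σ; ∃; _×_; _,_; proj₁)
open import Data.Sum using (_⊎_)
open import Relation.Nullary using (¬_; Dec; yes; no)
open import Relation.Nullary.Decidable using (_×-dec_; _⊎-dec_; ¬?)
open import Relation.Binary.PropositionalEquality as ≡ using (_≡_)
open import Algebra.Bundles using (CommutativeRing)
open import Function.Bundles using (Inverse)

record IsFieldCR {c ℓ} (R : CommutativeRing c ℓ) : Set (c ⊔ ℓ) where
  open CommutativeRing R
  field
    0≉1     : ¬ (0# ≈ 1#)
    inverse : ∀ x → ¬ (x ≈ 0#) → ∃ λ y → x * y ≈ 1#

record FiniteField (q : ℕ) : Set₁ where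
  field
    cring   : CommutativeRing Level.zero Level.zero
    isField : IsFieldCR cring
    card    : Inverse (CommutativeRing.setoid cring) (≡.setoid (Fin q))
  open CommutativeRing cring public

module Product {k : ℕ} {q : Fin k → ℕ} (F : (i : Fin k) → FiniteField (q i)) where

  Carrier : Set
  Carrier = (i : Fin k) → FiniteField.Carrier (F i)

  _≈_ : Carrier → Carrier → Set
  x ≈ y = ∀ i → FiniteField._≈_ (F i) (x i) (y i)

  _*_ : Carrier → Carrier → Carrier
  (x * y) i = FiniteField._*_ (F i) (x i) (y i)

  0# : Carrier
  0# i = FiniteField.0# (F i)

  1# : Carrier
  1# i = FiniteField.1# (F i)

  IsUnit : Carrier → Set
  IsUnit x = ∃ λ y → (x * y) ≈ 1#

  _∈R_ : Carrier → Carrier → Set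
  x ∈R y = ∃ λ r → x ≈ (r * y)

  Vertex : Set
  Vertex = Σ Carrier λ x → ¬ (x ≈ 0#) × ¬ IsUnit x

  _≈V_ : Vertex → Vertex → Set
  u ≈V v = proj₁ u ≈ proj₁ v

  Adj : Vertex → Vertex → Set
  Adj u v = ¬ (u ≈V v) × ¬ (proj₁ u ∈R proj₁ v) × ¬ (proj₁ v ∈R proj₁ u)

module Graph {V : Set} (_≈_ : V → V → Set) (Adj : V → V → Set) where

  data Walk : V → V → ℕ → Set where
    stop : ∀ {x y} → x ≈ y → Walk x y zero
    step : ∀ {x z y n} → Adj x z → Walk z y n → Walk x y (ℕ.suc n)

  -- d is the shortest-path distance function (in particular, the graph is
  -- connected): d x y is realised by a walk and no walk is shorter.
  IsDistance : (V → V → ℕ) → Set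
  IsDistance d = ∀ x y → Walk x y (d x y) × (∀ n → Walk x y n → d x y ℕ.≤ n)

  IsEnumeration : List V → Set
  IsEnumeration vs = (∀ v → Any (v ≈_) vs) × AllPairs (λ a b → ¬ (a ≈ b)) vs

pairSum : ∀ {A : Set} → (A → A → ℕ) → List A → ℕ
pairSum f []       = 0
pairSum f (a ∷ as) = sum (map (f a) as) ℕ.+ pairSum f as

module _ {V : Set} (_≈_ : V → V → Set) (Adj : V → V → Set) where
  open Graph _≈_ Adj

  IsWienerIndex : ℕ → Set
  IsWienerIndex w = Σ (V → V → ℕ) λ d → IsDistance d ×
                      (∀ vs → IsEnumeration vs → pairSum d vs ≡ w)

allSubsets : ∀ n → List (Subset n)
allSubsets zero        = Vec.[] ∷ []
allSubsets (ℕ.suc n)   = concatMap (λ s → (false Vec.∷ s) ∷ (true Vec.∷ s) ∷ []) (allSubsets n)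

IsNonemptyProper : ∀ {k} → Subset k → Set
IsNonemptyProper A = Nonempty A × Nonempty (∁ A)

𝒫 : ∀ k → List (Subset k)
𝒫 k = filter (λ A → nonempty? A ×-dec nonempty? (∁ A)) (allSubsets k)

m : ∀ {k} → (Fin k → ℕ) → Subset k → ℕ
m {k} q A = product (map (λ i → if lookup A i then q i ∸ 1 else 1) (allFin k))

Incomparable : ∀ {k} → Subset k → Subset k → Set
Incomparable A B = ¬ (A ⊆ B) × ¬ (B ⊆ A)

Nested : ∀ {k} → Subset k → Subset k → Set
Nested A B = (A ⊆ B) ⊎ (B ⊆ A)

termD₁ : ∀ {k} → (Fin k → ℕ) → Subset k → Subset k → ℕ
termD₁ q A B with ¬? (A ⊆? B) ×-dec ¬? (B ⊆? A)
... | yes _ = m q A ℕ.* m q B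
... | no  _ = 0

termD₂ : ∀ {k} → (Fin k → ℕ) → Subset k → Subset k → ℕ
termD₂ q A B with (A ⊆? B) ⊎-dec (B ⊆? A)
... | yes _ = m q A ℕ.* m q B
... | no  _ = 0

wienerFormula : (k : ℕ) → (Fin k → ℕ) → ℕ
wienerFormula k q =
    2 ℕ.* sum (map (λ A → m q A C 2) (𝒫 k))
  ℕ.+ pairSum (termD₁ q) (𝒫 k)
  ℕ.+ 2 ℕ.* pairSum (termD₂ q) (𝒫 k)

module Submission where

-- An element x of R = F_{q_1} × ⋯ × F_{q_k} is determined up to units by its support
-- S(x) = {i | x_i ≠ 0}: x ∈ Ry iff S(x) ⊆ S(y), and x is a non-zero non-unit iff S(x) is a
-- non-empty proper subset of [k]. So two distinct vertices are adjacent iff their supports are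
-- incomparable, and otherwise they are at distance 2 through the basis vector e_j for any j
-- outside both supports (k ≥ 2 makes e_j a vertex). Exactly ∏_{i∈A}(q_i − 1) vertices have
-- support A. Doubling the Wiener index and adding the diagonal gives a double sum over vertices,
-- which groups by supports into the double sum over 𝒫 weighted by these counts; there the
-- diagonal terms A = B produce the binomial terms through n² = 2·C(n,2) + n.

open import Defs

open import Algebra.Bundles using (CommutativeRing)
open import Data.Bool using (Bool; true; false; if_then_else_)
open import Data.Empty using (⊥-elim)
open import Data.Fin using (Fin; zero; suc; punchIn; punchOut; _≟_)
open import Data.Fin.Properties
  using (all?; inj⇒≟; ¬∀⟶∃¬; punchInᵢ≢i; punchIn-punchOut; punchIn-injective)
open import Data.Fin.Subset using (Subset; _⊆_; Nonempty; ∁; _∈_; _∉_)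
open import Data.Fin.Subset.Properties using (_⊆?_; nonempty?; x∈∁p⇒x∉p; x∉p⇒x∈∁p)
open import Data.List using (List; []; _∷_; _++_; map; concatMap; length; tabulate; allFin)
open import Data.List.Properties
  using (map-cong; map-++; map-∘; map-tabulate; length-++; length-map; length-tabulate)
  renaming (tabulate-cong to List-tabulate-cong)
open import Data.List.Membership.Propositional.Properties using (∈-allFin; ∈-filter⁺)
open import Data.List.Relation.Unary.All as All using (All; []; _∷_)
import Data.List.Relation.Unary.All.Properties as AllP
open import Data.List.Relation.Unary.AllPairs as AllPairs using (AllPairs; []; _∷_)
import Data.List.Relation.Unary.AllPairs.Properties as APP
open import Data.List.Relation.Unary.Any as Any using (Any; here; there)
import Data.List.Relation.Unary.Any.Properties as AnyP
open import Data.Nat using (ℕ; zero; suc; _+_; _*_; _∸_; _≤_; z≤n; s≤s)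
open import Data.Nat.Combinatorics using (_C_; nC1≡n; nCk+nC[k+1]≡[n+1]C[k+1])
open import Data.Nat.ListAction using (sum; product)
open import Data.Nat.ListAction.Properties using (sum-++)
open import Data.Nat.Properties
  using (+-commutativeSemigroup; +-assoc; +-identityʳ; *-assoc; *-comm; *-identityʳ; *-zeroʳ;
         *-distribˡ-+; +-cancelʳ-≡; *-cancelˡ-≡; ≤-refl; ≤-trans)
open import Data.Nat.Tactic.RingSolver using (solve-∀)
open import Algebra.Properties.CommutativeSemigroup +-commutativeSemigroup
  using () renaming (interchange to +-interchange; x∙yz≈y∙xz to +-exchange)
open import Data.Product using (_×_; _,_; ∃; proj₁; proj₂; swap)
open import Data.Sum using (inj₁; inj₂)
open import Data.Unit using (⊤; tt)
import Data.Vec as Vec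
open import Data.Vec.Properties
  using (lookup⇒[]=; []=⇒lookup; lookup∘tabulate; tabulate∘lookup; tabulate-cong)
open import Function using (_∘_; id)
open import Function.Bundles using (Inverse; Injection; mk⇔)
open import Function.Properties.Inverse using (Inverse⇒Injection)
open import Level using (0ℓ)
open import Relation.Binary.Bundles using (Setoid)
open import Relation.Binary.Structures using (IsEquivalence)
open import Relation.Binary.PropositionalEquality
  using (_≡_; refl; sym; trans; cong; cong₂; subst; module ≡-Reasoning)
import Relation.Binary.PropositionalEquality as ≡
import Relation.Binary.Reasoning.Setoid as ≈-Reasoning
open import Relation.Nullary using (¬_; Dec; yes; no; does)
open import Relation.Nullary.Decidable
  using (_×-dec_; _⊎-dec_; ¬?; dec-true; dec-false; does-⇔; decidable-stable)

sum-map-const : ∀ {A : Set} (c : ℕ) (xs : List A) → sum (map (λ _ → c) xs) ≡ length xs * c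
sum-map-const c []       = refl
sum-map-const c (x ∷ xs) = cong (c +_) (sum-map-const c xs)

sum-map-*ˡ : ∀ {A : Set} (c : ℕ) (f : A → ℕ) xs → sum (map (λ x → c * f x) xs) ≡ c * sum (map f xs)
sum-map-*ˡ c f []       = sym (*-zeroʳ c)
sum-map-*ˡ c f (x ∷ xs) = trans (cong (c * f x +_) (sum-map-*ˡ c f xs)) (sym (*-distribˡ-+ c (f x) _))

sum-map-+ : ∀ {A : Set} (f g : A → ℕ) xs →
            sum (map (λ x → f x + g x) xs) ≡ sum (map f xs) + sum (map g xs)
sum-map-+ f g []       = refl
sum-map-+ f g (x ∷ xs) = trans (cong (f x + g x +_) (sum-map-+ f g xs)) (+-interchange (f x) (g x) _ _)

sum-map-cong-All : ∀ {A : Set} {f g : A → ℕ} {xs} → All (λ x → f x ≡ g x) xs →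
                   sum (map f xs) ≡ sum (map g xs)
sum-map-cong-All []          = refl
sum-map-cong-All (fx≡gx ∷ p) = cong₂ _+_ fx≡gx (sum-map-cong-All p)

sum-concatMap : ∀ {A B : Set} (f : A → List B) (h : B → ℕ) xs →
                sum (map h (concatMap f xs)) ≡ sum (map (λ x → sum (map h (f x))) xs)
sum-concatMap f h []       = refl
sum-concatMap f h (x ∷ xs) = begin
  sum (map h (f x ++ concatMap f xs))              ≡⟨ cong sum (map-++ h (f x) _) ⟩
  sum (map h (f x) ++ map h (concatMap f xs))      ≡⟨ sum-++ (map h (f x)) _ ⟩
  sum (map h (f x)) + sum (map h (concatMap f xs)) ≡⟨ cong (sum (map h (f x)) +_) (sum-concatMap f h xs) ⟩
  sum (map h (f x)) + sum (map (λ x → sum (map h (f x))) xs) ∎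
  where open ≡-Reasoning

length-concatMap : ∀ {A B : Set} (f : A → List B) xs → length (concatMap f xs) ≡ sum (map (length ∘ f) xs)
length-concatMap f []       = refl
length-concatMap f (x ∷ xs) = trans (length-++ (f x)) (cong (length (f x) +_) (length-concatMap f xs))

pairSum-cong : ∀ {A : Set} {R : A → A → Set} {f g : A → A → ℕ} →
               (∀ {x y} → R x y → f x y ≡ g x y) → ∀ {xs} → AllPairs R xs → pairSum f xs ≡ pairSum g xs
pairSum-cong f≡g []         = refl
pairSum-cong f≡g (Rx ∷ Rxs) = cong₂ _+_ (sum-map-cong-All (All.map f≡g Rx)) (pairSum-cong f≡g Rxs)

pairSum-ext : ∀ {A : Set} {f g : A → A → ℕ} → (∀ x y → f x y ≡ g x y) → ∀ xs → pairSum f xs ≡ pairSum g xs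
pairSum-ext f≡g []       = refl
pairSum-ext f≡g (x ∷ xs) = cong₂ _+_ (cong sum (map-cong (f≡g x) xs)) (pairSum-ext f≡g xs)

pairSum-+ : ∀ {A : Set} (f g : A → A → ℕ) xs →
            pairSum (λ x y → f x y + g x y) xs ≡ pairSum f xs + pairSum g xs
pairSum-+ f g []       = refl
pairSum-+ f g (x ∷ xs) = trans (cong₂ _+_ (sum-map-+ (f x) (g x) xs) (pairSum-+ f g xs))
                               (+-interchange (sum (map (f x) xs)) _ _ _)

pairSum-*ˡ : ∀ {A : Set} (c : ℕ) (f : A → A → ℕ) xs → pairSum (λ x y → c * f x y) xs ≡ c * pairSum f xs
pairSum-*ˡ c f []       = sym (*-zeroʳ c)
pairSum-*ˡ c f (x ∷ xs) = trans (cong₂ _+_ (sum-map-*ˡ c (f x) xs) (pairSum-*ˡ c f xs))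
                                (sym (*-distribˡ-+ c _ _))

doubleSum : ∀ {A B : Set} → (A → B → ℕ) → List A → List B → ℕ
doubleSum f xs ys = sum (map (λ x → sum (map (f x) ys)) xs)

pairSum-doubleSum : ∀ {A : Set} (f : A → A → ℕ) → (∀ x y → f x y ≡ f y x) → ∀ xs →
                    2 * pairSum f xs + sum (map (λ x → f x x) xs) ≡ doubleSum f xs xs
pairSum-doubleSum f f-sym []       = refl
pairSum-doubleSum f f-sym (a ∷ as) = begin
  2 * (row + pairSum f as) + (f a a + diagonal)
    ≡⟨ regroup row (pairSum f as) (f a a) diagonal ⟩
  (f a a + row) + (row + (2 * pairSum f as + diagonal))
    ≡⟨ cong₂ (λ s t → (f a a + row) + (s + t)) (cong sum (map-cong (f-sym a) as)) (pairSum-doubleSum f f-sym as) ⟩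
  (f a a + row) + (sum (map (λ x → f x a) as) + doubleSum f as as)
    ≡⟨ cong ((f a a + row) +_) (sum-map-+ (λ x → f x a) (λ x → sum (map (f x) as)) as) ⟨
  doubleSum f (a ∷ as) (a ∷ as) ∎
  where
  open ≡-Reasoning
  row diagonal : ℕ
  row = sum (map (f a) as)
  diagonal = sum (map (λ x → f x x) as)
  regroup : ∀ s p d r → 2 * (s + p) + (d + r) ≡ (d + s) + (s + (2 * p + r))
  regroup = solve-∀

module _ {X B : Set} (σ : X → B) (c : B → ℕ) (xs : List X) (bs : List B)
         (fibres : ∀ h → sum (map (h ∘ σ) xs) ≡ sum (map (λ b → c b * h b) bs)) where

  doubleSum-fibres : (δ : B → B → ℕ) →
    doubleSum (λ x y → δ (σ x) (σ y)) xs xs ≡ doubleSum (λ a b → c a * c b * δ a b) bs bs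
  doubleSum-fibres δ = begin
    doubleSum (λ x y → δ (σ x) (σ y)) xs xs
      ≡⟨ cong sum (map-cong (λ x → fibres (δ (σ x))) xs) ⟩
    sum (map (λ x → sum (map (λ b → c b * δ (σ x) b) bs)) xs)
      ≡⟨ fibres (λ a → sum (map (λ b → c b * δ a b) bs)) ⟩
    sum (map (λ a → c a * sum (map (λ b → c b * δ a b) bs)) bs)
      ≡⟨ cong sum (map-cong (λ a → sym (sum-map-*ˡ (c a) (λ b → c b * δ a b) bs)) bs) ⟩
    doubleSum (λ a b → c a * (c b * δ a b)) bs bs
      ≡⟨ cong sum (map-cong (λ a → cong sum (map-cong (λ b → sym (*-assoc (c a) (c b) (δ a b))) bs)) bs) ⟩
    doubleSum (λ a b → c a * c b * δ a b) bs bs ∎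
    where open ≡-Reasoning

  pairSum-fibres : (δ : B → B → ℕ) → (∀ a b → δ a b ≡ δ b a) →
    2 * pairSum (λ x y → δ (σ x) (σ y)) xs + sum (map (λ b → c b * δ b b) bs) ≡
    2 * pairSum (λ a b → c a * c b * δ a b) bs + sum (map (λ b → c b * c b * δ b b) bs)
  pairSum-fibres δ δ-sym = begin
    2 * pairSum δσ xs + sum (map (λ b → c b * δ b b) bs)
      ≡⟨ cong (2 * pairSum δσ xs +_) (fibres (λ b → δ b b)) ⟨
    2 * pairSum δσ xs + sum (map (λ x → δσ x x) xs)
      ≡⟨ pairSum-doubleSum δσ (λ x y → δ-sym (σ x) (σ y)) xs ⟩
    doubleSum δσ xs xs
      ≡⟨ doubleSum-fibres δ ⟩
    doubleSum weighted bs bs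
      ≡⟨ pairSum-doubleSum weighted weighted-sym bs ⟨
    2 * pairSum weighted bs + sum (map (λ b → weighted b b) bs) ∎
    where
    open ≡-Reasoning
    δσ : X → X → ℕ
    δσ x y = δ (σ x) (σ y)
    weighted : B → B → ℕ
    weighted a b = c a * c b * δ a b
    weighted-sym : ∀ a b → weighted a b ≡ weighted b a
    weighted-sym a b = trans (cong (c a * c b *_) (δ-sym a b)) (cong (_* δ b a) (*-comm (c a) (c b)))

record Enumerates {A : Set} (_≈_ : A → A → Set) (P : A → Set) (xs : List A) : Set where
  field
    sound    : All P xs
    complete : ∀ x → P x → Any (x ≈_) xs
    distinct : AllPairs (λ a b → ¬ a ≈ b) xs

Enumerates-resp : ∀ {A : Set} {_≈_ : A → A → Set} {P Q : A → Set} → (∀ x → P x → Q x) → (∀ x → Q x → P x) →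
                  ∀ {xs} → Enumerates _≈_ P xs → Enumerates _≈_ Q xs
Enumerates-resp P⇒Q Q⇒P enum = record
  { sound    = All.map (P⇒Q _) (sound enum)
  ; complete = λ x Qx → complete enum x (Q⇒P x Qx)
  ; distinct = distinct enum
  }
  where open Enumerates

sum-map-─ : ∀ {A : Set} {P : A → Set} (f : A → ℕ) {ys : List A} (p : Any P ys) →
            sum (map f ys) ≡ f (Any.lookup p) + sum (map f (ys Any.─ p))
sum-map-─ f (here _)                = refl
sum-map-─ f {ys = y ∷ ys} (there p) = trans (cong (f y +_) (sum-map-─ f p)) (+-exchange (f y) (f (Any.lookup p)) _)

AllPairs-─⁺ : ∀ {A : Set} {P : A → Set} {R : A → A → Set} {ys} (p : Any P ys) → AllPairs R ys → AllPairs R (ys Any.─ p)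
AllPairs-─⁺ (here _)  (_ ∷ Rys)  = Rys
AllPairs-─⁺ (there p) (Ry ∷ Rys) = AllP.─⁺ p Ry ∷ AllPairs-─⁺ p Rys

Any-─⁺ : ∀ {A : Set} {P Q : A → Set} {ys} (p : Any P ys) → Any Q ys → ¬ Q (Any.lookup p) → Any Q (ys Any.─ p)
Any-─⁺ (here _)  (here Qy)   ¬Qy = ⊥-elim (¬Qy Qy)
Any-─⁺ (here _)  (there Qys) _   = Qys
Any-─⁺ (there p) (here Qy)   _   = here Qy
Any-─⁺ (there p) (there Qys) ¬Q  = there (Any-─⁺ p Qys ¬Q)

module _ {A : Set} {_≈_ : A → A → Set} (≈-equiv : IsEquivalence _≈_) where
  open IsEquivalence ≈-equiv using () renaming (sym to ≈-sym; trans to ≈-trans)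

  distinct-─ : ∀ {P : A → Set} {ys} (p : Any P ys) → AllPairs (λ a b → ¬ a ≈ b) ys →
               All (λ z → ¬ z ≈ Any.lookup p) (ys Any.─ p)
  distinct-─ (here _)  (y≉ys ∷ _)   = All.map (λ y≉z z≈y → y≉z (≈-sym z≈y)) y≉ys
  distinct-─ (there p) (y≉ys ∷ ys≉) = proj₁ (All.lookupAny y≉ys p) ∷ distinct-─ p ys≉

  -- Induction on xs: remove x from xs and its ≈-partner from ys; both remainders enumerate P minus x.
  enumeration-sum-invariant : ∀ {P : A → Set} {f : A → ℕ} → (∀ {a b} → a ≈ b → f a ≡ f b) →
    ∀ {xs ys} → Enumerates _≈_ P xs → Enumerates _≈_ P ys → sum (map f xs) ≡ sum (map f ys)
  enumeration-sum-invariant f-resp {[]} {[]} _ _ = refl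
  enumeration-sum-invariant f-resp {[]} {y ∷ _} enum-xs enum-ys
    with () ← Enumerates.complete enum-xs y (All.head (Enumerates.sound enum-ys))
  enumeration-sum-invariant {P} {f} f-resp {x ∷ xs} {ys} enum-xs enum-ys = begin
    f x + sum (map f xs)                         ≡⟨ cong₂ _+_ (f-resp x≈y) (enumeration-sum-invariant f-resp rest-xs rest-ys) ⟩
    f (Any.lookup p) + sum (map f (ys Any.─ p))  ≡⟨ sum-map-─ f p ⟨
    sum (map f ys)                               ∎
    where
    open ≡-Reasoning
    open Enumerates
    Px : P x
    Px = All.head (sound enum-xs)
    p : Any (x ≈_) ys
    p = complete enum-ys x Px
    x≈y : x ≈ Any.lookup p
    x≈y = AnyP.lookup-result p
    x≉xs : All (λ b → ¬ x ≈ b) xs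
    x≉xs = AllPairs.head (distinct enum-xs)
    P′ : A → Set
    P′ z = P z × ¬ z ≈ x
    rest-xs : Enumerates _≈_ P′ xs
    rest-xs = record
      { sound    = All.zipWith (λ (Pz , x≉z) → Pz , λ z≈x → x≉z (≈-sym z≈x)) (All.tail (sound enum-xs) , x≉xs)
      ; complete = λ z (Pz , z≉x) → Any.tail z≉x (complete enum-xs z Pz)
      ; distinct = AllPairs.tail (distinct enum-xs)
      }
    rest-ys : Enumerates _≈_ P′ (ys Any.─ p)
    rest-ys = record
      { sound    = All.zipWith (λ (Pz , z≉y) → Pz , λ z≈x → z≉y (≈-trans z≈x x≈y))
                               (AllP.─⁺ p (sound enum-ys) , distinct-─ p (distinct enum-ys))
      ; complete = λ z (Pz , z≉x) → Any-─⁺ p (complete enum-ys z Pz) (λ z≈y → z≉x (≈-trans z≈y (≈-sym x≈y)))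
      ; distinct = AllPairs-─⁺ p (distinct enum-ys)
      }

Fin-cons : ∀ {k} {X : Fin (suc k) → Set} → X zero → ((i : Fin k) → X (suc i)) → (i : Fin (suc k)) → X i
Fin-cons a g zero    = a
Fin-cons a g (suc i) = g i

choices : ∀ {k} {X : Fin k → Set} → ((i : Fin k) → List (X i)) → List ((i : Fin k) → X i)
choices {zero}  L = (λ ()) ∷ []
choices {suc k} L = concatMap (λ a → map (Fin-cons a) (choices (L ∘ suc))) (L zero)

length-choices : ∀ {k} {X : Fin k → Set} (L : (i : Fin k) → List (X i)) →
                 length (choices L) ≡ product (tabulate (length ∘ L))
length-choices {zero}  L = refl
length-choices {suc k} L = begin
  length (choices L)                                         ≡⟨ length-concatMap _ (L zero) ⟩
  sum (map (λ a → length (map (Fin-cons a) (choices (L ∘ suc)))) (L zero))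
    ≡⟨ cong sum (map-cong (λ a → length-map (Fin-cons a) (choices (L ∘ suc))) (L zero)) ⟩
  sum (map (λ _ → length (choices (L ∘ suc))) (L zero))     ≡⟨ sum-map-const _ (L zero) ⟩
  length (L zero) * length (choices (L ∘ suc))               ≡⟨ cong (length (L zero) *_) (length-choices (L ∘ suc)) ⟩
  product (tabulate (length ∘ L))                            ∎
  where open ≡-Reasoning

Pointwise : ∀ {k} {X : Fin k → Set} → (∀ i → X i → X i → Set) → ((i : Fin k) → X i) → ((i : Fin k) → X i) → Set
Pointwise _≈_ x y = ∀ i → _≈_ i (x i) (y i)

All-choices : ∀ {k} {X : Fin k → Set} {P : (i : Fin k) → X i → Set} (L : (i : Fin k) → List (X i)) →
              (∀ i → All (P i) (L i)) → All (λ x → ∀ i → P i (x i)) (choices L)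
All-choices {zero}  L _ = (λ ()) ∷ []
All-choices {suc k} L PL = AllP.concat⁺ (AllP.map⁺ (All.map
    (λ Pa → AllP.map⁺ (All.map (Fin-cons Pa) (All-choices (L ∘ suc) (PL ∘ suc))))
    (PL zero)))

Any-choices : ∀ {k} {X : Fin k → Set} (_≈_ : ∀ i → X i → X i → Set) (L : (i : Fin k) → List (X i))
              (x : (i : Fin k) → X i) → (∀ i → Any (_≈_ i (x i)) (L i)) → Any (Pointwise _≈_ x) (choices L)
Any-choices {zero}  _≈_ L x _ = here (λ ())
Any-choices {suc k} _≈_ L x x∈L = AnyP.concat⁺ (AnyP.map⁺ (Any.map
    (λ x₀≈a → AnyP.map⁺ (Any.map (Fin-cons x₀≈a)
                                  (Any-choices (_≈_ ∘ suc) (L ∘ suc) (x ∘ suc) (x∈L ∘ suc))))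
    (x∈L zero)))

AllPairs-choices : ∀ {k} {X : Fin k → Set} (_≈_ : ∀ i → X i → X i → Set) (L : (i : Fin k) → List (X i)) →
    (∀ i → AllPairs (λ a b → ¬ _≈_ i a b) (L i)) → AllPairs (λ x y → ¬ Pointwise _≈_ x y) (choices L)
AllPairs-choices {zero}  _≈_ L _ = [] ∷ []
AllPairs-choices {suc k} {X} _≈_ L distinct = APP.concat⁺ {xss = map block (L zero)}
    (AllP.map⁺ (All.tabulate (λ _ → APP.map⁺ (AllPairs.map (λ g≉h ag≈ah → g≉h (ag≈ah ∘ suc)) rest-distinct))))
    (APP.map⁺ (AllPairs.map (λ a≉b → AllP.map⁺ (All.tabulate (λ _ →
                              AllP.map⁺ (All.tabulate (λ _ ag≈bh → a≉b (ag≈bh zero))))))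
                            (distinct zero)))
    where
    block : X zero → List ((i : Fin (suc k)) → X i)
    block a = map (Fin-cons a) (choices (L ∘ suc))
    rest-distinct : AllPairs (λ x y → ¬ Pointwise (_≈_ ∘ suc) x y) (choices (L ∘ suc))
    rest-distinct = AllPairs-choices (_≈_ ∘ suc) (L ∘ suc) (distinct ∘ suc)

choices-enumerates : ∀ {k} {X : Fin k → Set} (_≈_ : ∀ i → X i → X i → Set) {P : ∀ i → X i → Set}
  (L : (i : Fin k) → List (X i)) → (∀ i → Enumerates (_≈_ i) (P i) (L i)) →
  Enumerates (Pointwise _≈_) (λ x → ∀ i → P i (x i)) (choices L)
choices-enumerates _≈_ L enum = record
  { sound    = All-choices L (sound ∘ enum)
  ; complete = λ x Px → Any-choices _≈_ L x (λ i → complete (enum i) (x i) (Px i))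
  ; distinct = AllPairs-choices _≈_ L (distinct ∘ enum)
  }
  where open Enumerates

module _ {A B : Set} {_≈_ : A → A → Set} (σ : A → B) (σ-resp : ∀ {x y} → x ≈ y → σ x ≡ σ y)
         {R : B → Set} {bs : List B} (enum-bs : Enumerates _≡_ R bs)
         (fibre : B → List A) (enum-fibre : ∀ b → Enumerates _≈_ (λ x → σ x ≡ b) (fibre b)) where
  open Enumerates

  concatMap-enumerates : Enumerates _≈_ (R ∘ σ) (concatMap fibre bs)
  concatMap-enumerates = record
    { sound    = AllP.concat⁺ (AllP.map⁺ (All.map (λ {b} Rb → All.map (λ σx≡b → subst R (sym σx≡b) Rb)
                                                                   (sound (enum-fibre b)))
                                                  (sound enum-bs)))
    ; complete = λ x Rσx → AnyP.concat⁺ (AnyP.map⁺ (Any.map (λ {b} σx≡b → complete (enum-fibre b) x σx≡b)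
                                                           (complete enum-bs (σ x) Rσx)))
    ; distinct = APP.concat⁺ (AllP.map⁺ (All.tabulate (λ _ → distinct (enum-fibre _))))
                             (APP.map⁺ (AllPairs.map fibres-apart (distinct enum-bs)))
    }
    where
    fibres-apart : ∀ {a b} → ¬ a ≡ b → All (λ x → All (λ y → ¬ x ≈ y) (fibre b)) (fibre a)
    fibres-apart a≢b = All.map (λ σx≡a → All.map (λ σy≡b x≈y → a≢b (trans (sym σx≡a)
                                                                     (trans (σ-resp x≈y) σy≡b)))
                                                 (sound (enum-fibre _)))
                               (sound (enum-fibre _))

  enumeration-fibre-sum : IsEquivalence _≈_ → ∀ {xs} → Enumerates _≈_ (R ∘ σ) xs → (h : B → ℕ) →
                          sum (map (h ∘ σ) xs) ≡ sum (map (λ b → length (fibre b) * h b) bs)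
  enumeration-fibre-sum ≈-equiv {xs} enum-xs h = begin
    sum (map (h ∘ σ) xs)
      ≡⟨ enumeration-sum-invariant ≈-equiv (cong h ∘ σ-resp) enum-xs concatMap-enumerates ⟩
    sum (map (h ∘ σ) (concatMap fibre bs))
      ≡⟨ sum-concatMap fibre (h ∘ σ) bs ⟩
    sum (map (λ b → sum (map (h ∘ σ) (fibre b))) bs)
      ≡⟨ cong sum (map-cong fibre-sum bs) ⟩
    sum (map (λ b → length (fibre b) * h b) bs) ∎
    where
    open ≡-Reasoning
    fibre-sum : ∀ b → sum (map (h ∘ σ) (fibre b)) ≡ length (fibre b) * h b
    fibre-sum b = trans (sum-map-cong-All (All.map (cong h) (sound (enum-fibre b)))) (sum-map-const (h b) (fibre b))

allFinExcept : ∀ {n} → Fin n → List (Fin n)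
allFinExcept {suc n} i = map (punchIn i) (allFin n)

length-allFinExcept : ∀ {n} (i : Fin n) → length (allFinExcept i) ≡ n ∸ 1
length-allFinExcept {suc n} i = trans (length-map (punchIn i) (allFin n)) (length-tabulate id)

allFinExcept-enumerates : ∀ {n} (i : Fin n) → Enumerates _≡_ (λ j → ¬ j ≡ i) (allFinExcept i)
allFinExcept-enumerates {suc n} i = record
  { sound    = AllP.map⁺ (All.tabulate (λ {j} _ → punchInᵢ≢i i j))
  ; complete = λ j j≢i → AnyP.map⁺ (Any.map (λ j′≡ → trans (sym (punchIn-punchOut (j≢i ∘ sym)))
                                                             (cong (punchIn i) j′≡))
                                             (∈-allFin (punchOut (j≢i ∘ sym))))
  ; distinct = APP.map⁺ (AllPairs.map (λ j≢j′ → j≢j′ ∘ punchIn-injective i _ _) (APP.tabulate⁺ id))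
  }

module _ {n} {S : Setoid 0ℓ 0ℓ} (card : Inverse S (≡.setoid (Fin n))) where
  open Setoid S using (Carrier; _≈_) renaming (sym to ≈-sym; trans to ≈-trans)
  open Inverse card

  from-enumerates : ∀ {P : Fin n → Set} {js} → Enumerates _≡_ P js → Enumerates _≈_ (P ∘ to) (map from js)
  from-enumerates {P} enum = record
    { sound    = AllP.map⁺ (All.map (λ {j} Pj → subst P (sym (strictlyInverseˡ j)) Pj) (E.sound enum))
    ; complete = λ x Ptox → AnyP.map⁺ (Any.map (λ tox≡j → ≈-trans (≈-sym (strictlyInverseʳ x)) (from-cong tox≡j))
                                                (E.complete enum (to x) Ptox))
    ; distinct = APP.map⁺ (AllPairs.map (λ {i} {j} i≢j fi≈fj → i≢j (trans (sym (strictlyInverseˡ i))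
                                                                    (trans (to-cong fi≈fj) (strictlyInverseˡ j))))
                                         (E.distinct enum))
    }
    where module E = Enumerates

  others : Carrier → List Carrier
  others z = map from (allFinExcept (to z))

  others-enumerates : ∀ z → Enumerates _≈_ (λ a → ¬ a ≈ z) (others z)
  others-enumerates z = Enumerates-resp (λ a toa≢toz a≈z → toa≢toz (to-cong a≈z))
                                        (λ a a≉z toa≡toz → a≉z (to-injective toa≡toz))
                                        (from-enumerates (allFinExcept-enumerates (to z)))
    where
    to-injective : ∀ {a b} → to a ≡ to b → a ≈ b
    to-injective = Injection.injective (Inverse⇒Injection card)

  length-others : ∀ z → length (others z) ≡ n ∸ 1
  length-others z = trans (length-map from (allFinExcept (to z))) (length-allFinExcept (to z))

allSubsets-enumerates : ∀ n → Enumerates _≡_ (λ _ → ⊤) (allSubsets n)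
allSubsets-enumerates n = record
  { sound    = All.tabulate (λ _ → tt)
  ; complete = λ A _ → subset-listed n A
  ; distinct = subsets-distinct n
  }
  where
  extensions : ∀ {n} → Subset n → List (Subset (suc n))
  extensions s = (false Vec.∷ s) ∷ (true Vec.∷ s) ∷ []
  subset-listed : ∀ n (A : Subset n) → Any (A ≡_) (allSubsets n)
  subset-listed zero    Vec.[]       = here refl
  subset-listed (suc n) (b Vec.∷ A) = AnyP.concat⁺ (AnyP.map⁺ (Any.map (extension b) (subset-listed n A)))
    where
    extension : ∀ b {s} → A ≡ s → Any ((b Vec.∷ A) ≡_) (extensions s)
    extension false refl = here refl
    extension true  refl = there (here refl)
  subsets-distinct : ∀ n → AllPairs (λ A B → ¬ A ≡ B) (allSubsets n)
  subsets-distinct zero    = [] ∷ []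
  subsets-distinct (suc n) = APP.concat⁺ (AllP.map⁺ (All.tabulate (λ _ → ((λ ()) ∷ []) ∷ [] ∷ [])))
                                 (APP.map⁺ (AllPairs.map apart (subsets-distinct n)))
    where
    apart : ∀ {s t : Subset n} → ¬ s ≡ t → All (λ A → All (λ B → ¬ A ≡ B) (extensions t)) (extensions s)
    apart s≢t = (tails-differ ∷ tails-differ ∷ []) ∷ (tails-differ ∷ tails-differ ∷ []) ∷ []
      where
      tails-differ : ∀ {b c} → ¬ b Vec.∷ _ ≡ c Vec.∷ _
      tails-differ A≡B = s≢t (cong Vec.tail A≡B)

𝒫-enumerates : ∀ k → Enumerates _≡_ IsNonemptyProper (𝒫 k)
𝒫-enumerates k = record
  { sound    = AllP.all-filter nonemptyProper? (allSubsets k)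
  ; complete = λ A A∈𝒫 → ∈-filter⁺ nonemptyProper? (complete (allSubsets-enumerates k) A tt) A∈𝒫
  ; distinct = APP.filter⁺ nonemptyProper? (distinct (allSubsets-enumerates k))
  }
  where
  open Enumerates
  nonemptyProper? : (A : Subset k) → Dec (IsNonemptyProper A)
  nonemptyProper? A = nonempty? A ×-dec nonempty? (∁ A)

does-true⁻ : ∀ {A : Set} (a? : Dec A) → does a? ≡ true → A
does-true⁻ (yes a) _ = a

does-false⁻ : ∀ {A : Set} (a? : Dec A) → does a? ≡ false → ¬ A
does-false⁻ (no ¬a) _ = ¬a

module _ {n} {P : Fin n → Set} (P? : ∀ i → Dec (P i)) where

  ∈-tabulate⁺ : ∀ {i} → P i → i ∈ Vec.tabulate (does ∘ P?)
  ∈-tabulate⁺ {i} Pi = lookup⇒[]= i _ (trans (lookup∘tabulate (does ∘ P?) i) (dec-true (P? i) Pi))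

  ∈-tabulate⁻ : ∀ {i} → i ∈ Vec.tabulate (does ∘ P?) → P i
  ∈-tabulate⁻ {i} i∈ = does-true⁻ (P? i) (trans (sym (lookup∘tabulate (does ∘ P?) i)) ([]=⇒lookup i∈))

module _ {c ℓ} (K : CommutativeRing c ℓ) (K-field : IsFieldCR K) where
  open CommutativeRing K using (_≈_; 0#; 1#; setoid; zeroˡ)
    renaming (_*_ to _·_; *-identityʳ to ·-identityʳ; *-congˡ to ·-congˡ; *-congʳ to ·-congʳ;
              *-comm to ·-comm; *-assoc to ·-assoc)
  open IsFieldCR K-field
  open ≈-Reasoning setoid

  divisible : ∀ a b → Dec (b ≈ 0#) → (b ≈ 0# → a ≈ 0#) → ∃ λ r → a ≈ r · b
  divisible a b (yes b≈0) b≈0⇒a≈0 = 0# , (begin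
    a        ≈⟨ b≈0⇒a≈0 b≈0 ⟩
    0#       ≈⟨ zeroˡ b ⟨
    0# · b   ∎)
  divisible a b (no b≉0) _ with b⁻¹ , b·b⁻¹≈1 ← inverse b b≉0 = a · b⁻¹ , (begin
    a              ≈⟨ ·-identityʳ a ⟨
    a · 1#         ≈⟨ ·-congˡ b·b⁻¹≈1 ⟨
    a · (b · b⁻¹)  ≈⟨ ·-congˡ (·-comm b b⁻¹) ⟩
    a · (b⁻¹ · b)  ≈⟨ ·-assoc a b⁻¹ b ⟨
    a · b⁻¹ · b    ∎)

  zero-not-invertible : ∀ {a} b → a ≈ 0# → ¬ a · b ≈ 1#
  zero-not-invertible {a} b a≈0 a·b≈1 = 0≉1 (begin
    0#      ≈⟨ zeroˡ b ⟨
    0# · b  ≈⟨ ·-congʳ a≈0 ⟨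
    a · b   ≈⟨ a·b≈1 ⟩
    1#      ∎)

incomparable? : ∀ {n} (A B : Subset n) → Dec (Incomparable A B)
incomparable? A B = ¬? (A ⊆? B) ×-dec ¬? (B ⊆? A)

supportDistance : ∀ {n} → Subset n → Subset n → ℕ
supportDistance A B with incomparable? A B
... | yes _ = 1
... | no  _ = 2

supportDistance-sym : ∀ {n} (A B : Subset n) → supportDistance A B ≡ supportDistance B A
supportDistance-sym A B with incomparable? A B | incomparable? B A
... | yes _           | yes _           = refl
... | no  _           | no  _           = refl
... | yes (A⊈B , B⊈A) | no  ¬B∥A        = ⊥-elim (¬B∥A (B⊈A , A⊈B))
... | no  ¬A∥B        | yes (B⊈A , A⊈B) = ⊥-elim (¬A∥B (A⊈B , B⊈A))

supportDistance-diagonal : ∀ {n} (A : Subset n) → supportDistance A A ≡ 2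
supportDistance-diagonal A with incomparable? A A
... | yes (A⊈A , _) = ⊥-elim (A⊈A id)
... | no  _         = refl

supportDistance≤2 : ∀ {n} (A B : Subset n) → supportDistance A B ≤ 2
supportDistance≤2 A B with incomparable? A B
... | yes _ = s≤s z≤n
... | no  _ = ≤-refl

square≡2*C2+n : ∀ n → n * n ≡ 2 * (n C 2) + n
square≡2*C2+n zero    = refl
square≡2*C2+n (suc n) = begin
  suc n * suc n                ≡⟨ expand n ⟩
  2 * n + (n * n) + 1          ≡⟨ cong (λ t → 2 * n + t + 1) (square≡2*C2+n n) ⟩
  2 * n + (2 * (n C 2) + n) + 1 ≡⟨ regroup n (n C 2) ⟩
  2 * (n + n C 2) + suc n      ≡⟨ cong (λ t → 2 * (t + n C 2) + suc n) (nC1≡n n) ⟨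
  2 * (n C 1 + n C 2) + suc n  ≡⟨ cong (λ t → 2 * t + suc n) (nCk+nC[k+1]≡[n+1]C[k+1] n 1) ⟩
  2 * (suc n C 2) + suc n      ∎
  where
  open ≡-Reasoning
  expand : ∀ a → suc a * suc a ≡ 2 * a + a * a + 1
  expand = solve-∀
  regroup : ∀ a c → 2 * a + (2 * c + a) + 1 ≡ 2 * (a + c) + suc a
  regroup = solve-∀

module _ (k : ℕ) (q : Fin k → ℕ) where

  weightedDistance : Subset k → Subset k → ℕ
  weightedDistance A B = m q A * m q B * supportDistance A B

  weightedDistance≡terms : ∀ A B → weightedDistance A B ≡ termD₁ q A B + 2 * termD₂ q A B
  weightedDistance≡terms A B with incomparable? A B | (A ⊆? B) ⊎-dec (B ⊆? A)
  ... | yes (A⊈B , _) | yes (inj₁ A⊆B) = ⊥-elim (A⊈B A⊆B)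
  ... | yes (_ , B⊈A) | yes (inj₂ B⊆A) = ⊥-elim (B⊈A B⊆A)
  ... | yes _         | no  _          = trans (*-identityʳ (m q A * m q B)) (sym (+-identityʳ (m q A * m q B)))
  ... | no  _         | yes _          = *-comm (m q A * m q B) 2
  ... | no  ¬A∥B      | no  ¬nested    = ⊥-elim (¬A∥B (¬nested ∘ inj₁ , ¬nested ∘ inj₂))

  wienerFormula-doubled :
    2 * wienerFormula k q + sum (map (λ A → m q A * supportDistance A A) (𝒫 k)) ≡
    2 * pairSum weightedDistance (𝒫 k) + sum (map (λ A → m q A * m q A * supportDistance A A) (𝒫 k))
  wienerFormula-doubled = begin
    2 * (2 * ΣC + pairSum (termD₁ q) P + 2 * pairSum (termD₂ q) P) + D
      ≡⟨ cong (λ t → 2 * t + D) (+-assoc (2 * ΣC) _ _) ⟩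
    2 * (2 * ΣC + (pairSum (termD₁ q) P + 2 * pairSum (termD₂ q) P)) + D
      ≡⟨ cong (λ t → 2 * (2 * ΣC + t) + D) off-diagonal ⟩
    2 * (2 * ΣC + pairSum weightedDistance P) + D
      ≡⟨ regroup ΣC (pairSum weightedDistance P) D ⟩
    2 * pairSum weightedDistance P + (2 * (2 * ΣC) + D)
      ≡⟨ cong (2 * pairSum weightedDistance P +_) diagonal ⟩
    2 * pairSum weightedDistance P + sum (map (λ A → m q A * m q A * supportDistance A A) P) ∎
    where
    open ≡-Reasoning
    P : List (Subset k)
    P = 𝒫 k
    ΣC D : ℕ
    ΣC = sum (map (λ A → m q A C 2) P)
    D = sum (map (λ A → m q A * supportDistance A A) P)
    regroup : ∀ c p d → 2 * (2 * c + p) + d ≡ 2 * p + (2 * (2 * c) + d)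
    regroup = solve-∀
    off-diagonal : pairSum (termD₁ q) P + 2 * pairSum (termD₂ q) P ≡ pairSum weightedDistance P
    off-diagonal = begin
      pairSum (termD₁ q) P + 2 * pairSum (termD₂ q) P
        ≡⟨ cong (pairSum (termD₁ q) P +_) (pairSum-*ˡ 2 (termD₂ q) P) ⟨
      pairSum (termD₁ q) P + pairSum (λ A B → 2 * termD₂ q A B) P
        ≡⟨ pairSum-+ (termD₁ q) (λ A B → 2 * termD₂ q A B) P ⟨
      pairSum (λ A B → termD₁ q A B + 2 * termD₂ q A B) P
        ≡⟨ pairSum-ext (λ A B → sym (weightedDistance≡terms A B)) P ⟩
      pairSum weightedDistance P ∎
    diagonal-term : ∀ A → 2 * (2 * (m q A C 2)) + m q A * supportDistance A A ≡ m q A * m q A * supportDistance A A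
    diagonal-term A rewrite supportDistance-diagonal A =
      trans (factor (m q A C 2) (m q A)) (cong (_* 2) (sym (square≡2*C2+n (m q A))))
      where
      factor : ∀ c n → 2 * (2 * c) + n * 2 ≡ (2 * c + n) * 2
      factor = solve-∀
    diagonal : 2 * (2 * ΣC) + D ≡ sum (map (λ A → m q A * m q A * supportDistance A A) P)
    diagonal = begin
      2 * (2 * ΣC) + D
        ≡⟨ cong (λ t → 2 * t + D) (sum-map-*ˡ 2 (λ A → m q A C 2) P) ⟨
      2 * sum (map (λ A → 2 * (m q A C 2)) P) + D
        ≡⟨ cong (_+ D) (sum-map-*ˡ 2 (λ A → 2 * (m q A C 2)) P) ⟨
      sum (map (λ A → 2 * (2 * (m q A C 2))) P) + D
        ≡⟨ sum-map-+ (λ A → 2 * (2 * (m q A C 2))) (λ A → m q A * supportDistance A A) P ⟨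
      sum (map (λ A → 2 * (2 * (m q A C 2)) + m q A * supportDistance A A) P)
        ≡⟨ cong sum (map-cong diagonal-term P) ⟩
      sum (map (λ A → m q A * m q A * supportDistance A A) P) ∎

another : ∀ {k} → 2 ≤ k → (j : Fin k) → ∃ λ i → ¬ i ≡ j
another (s≤s (s≤s _)) zero    = suc zero , λ ()
another (s≤s (s≤s _)) (suc j) = zero , λ ()

module CozeroDivisorGraph {k : ℕ} {q : Fin k → ℕ} (F : (i : Fin k) → FiniteField (q i)) where
  open Product F using (IsUnit; _∈R_; Vertex; _≈V_; Adj) renaming (Carrier to R; _≈_ to _≈ᴿ_; 0# to 0ᴿ)
  open Graph _≈V_ Adj

  module 𝔽 (i : Fin k) where
    open FiniteField (F i) public
    open IsFieldCR isField public

  _≟ᵢ_ : ∀ {i} (a b : 𝔽.Carrier i) → Dec (𝔽._≈_ i a b)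
  _≟ᵢ_ {i} = inj⇒≟ (Inverse⇒Injection (𝔽.card i))

  _≟ᴿ_ : (x y : R) → Dec (x ≈ᴿ y)
  x ≟ᴿ y = all? (λ i → x i ≟ᵢ y i)

  ≈ᴿ-isEquivalence : IsEquivalence _≈ᴿ_
  ≈ᴿ-isEquivalence = record
    { refl  = λ i → 𝔽.refl i
    ; sym   = λ x≈y i → 𝔽.sym i (x≈y i)
    ; trans = λ x≈y y≈z i → 𝔽.trans i (x≈y i) (y≈z i)
    }

  open IsEquivalence ≈ᴿ-isEquivalence using () renaming (refl to ≈ᴿ-refl)

  nonzero? : ∀ {i} (a : 𝔽.Carrier i) → Dec (¬ 𝔽._≈_ i a (𝔽.0# i))
  nonzero? a = ¬? (a ≟ᵢ _)

  support : R → Subset k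
  support x = Vec.tabulate (λ i → does (nonzero? (x i)))

  ∈-support⁺ : ∀ {x i} → ¬ 𝔽._≈_ i (x i) (𝔽.0# i) → i ∈ support x
  ∈-support⁺ {x} = ∈-tabulate⁺ (λ i → nonzero? (x i))

  ∈-support⁻ : ∀ {x i} → i ∈ support x → ¬ 𝔽._≈_ i (x i) (𝔽.0# i)
  ∈-support⁻ {x} = ∈-tabulate⁻ (λ i → nonzero? (x i))

  ∉-support⁻ : ∀ {x i} → i ∉ support x → 𝔽._≈_ i (x i) (𝔽.0# i)
  ∉-support⁻ {x} {i} i∉ with x i ≟ᵢ 𝔽.0# i
  ... | yes xᵢ≈0 = xᵢ≈0
  ... | no  xᵢ≉0 = ⊥-elim (i∉ (∈-support⁺ xᵢ≉0))

  support-cong : ∀ {x y} → x ≈ᴿ y → support x ≡ support y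
  support-cong {x} {y} x≈y = tabulate-cong (λ i → does-⇔ (mk⇔ (λ x≉0 y≈0 → x≉0 (𝔽.trans i (x≈y i) y≈0))
                                                             (λ y≉0 x≈0 → y≉0 (𝔽.trans i (𝔽.sym i (x≈y i)) x≈0)))
                                                        (nonzero? (x i)) (nonzero? (y i)))

  ∈R⇒support⊆ : ∀ {x y} → x ∈R y → support x ⊆ support y
  ∈R⇒support⊆ (r , x≈ry) {i} i∈x =
    ∈-support⁺ λ yᵢ≈0 → ∈-support⁻ i∈x
      (𝔽.trans i (x≈ry i) (𝔽.trans i (𝔽.*-congˡ i yᵢ≈0) (𝔽.zeroʳ i (r i))))

  support⊆⇒∈R : ∀ {x y} → support x ⊆ support y → x ∈R y
  support⊆⇒∈R {x} {y} sx⊆sy = (λ i → proj₁ (xᵢ-divisible i)) , (λ i → proj₂ (xᵢ-divisible i))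
    where
    xᵢ-divisible : ∀ i → ∃ λ r → 𝔽._≈_ i (x i) (𝔽._*_ i r (y i))
    xᵢ-divisible i = divisible (𝔽.cring i) (𝔽.isField i) (x i) (y i) (y i ≟ᵢ _)
                               (λ yᵢ≈0 → ∉-support⁻ (λ i∈x → ∈-support⁻ (sx⊆sy i∈x) yᵢ≈0))

  IsVertex : R → Set
  IsVertex x = ¬ x ≈ᴿ 0ᴿ × ¬ IsUnit x

  vertex⇒nonemptyProper : ∀ {x} → IsVertex x → IsNonemptyProper (support x)
  vertex⇒nonemptyProper {x} (x≉0 , x-nonunit) = nonempty , nonempty-complement
    where
    nonempty : Nonempty (support x)
    nonempty with i , xᵢ≉0 ← ¬∀⟶∃¬ k _ (λ i → x i ≟ᵢ 𝔽.0# i) x≉0 = i , ∈-support⁺ xᵢ≉0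
    nonzero⇒unit : (∀ i → ¬ 𝔽._≈_ i (x i) (𝔽.0# i)) → IsUnit x
    nonzero⇒unit x≉0 = (λ i → proj₁ (𝔽.inverse i (x i) (x≉0 i))) , (λ i → proj₂ (𝔽.inverse i (x i) (x≉0 i)))
    nonempty-complement : Nonempty (∁ (support x))
    nonempty-complement with i , ¬xᵢ≉0 ← ¬∀⟶∃¬ k _ (λ i → nonzero? (x i)) (x-nonunit ∘ nonzero⇒unit) =
      i , x∉p⇒x∈∁p (¬xᵢ≉0 ∘ ∈-support⁻)

  nonemptyProper⇒vertex : ∀ {x} → IsNonemptyProper (support x) → IsVertex x
  nonemptyProper⇒vertex {x} ((i , i∈x) , (j , j∈∁x)) = (λ x≈0 → ∈-support⁻ i∈x (x≈0 i)) , nonunit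
    where
    nonunit : ¬ IsUnit x
    nonunit (y , xy≈1) =
      zero-not-invertible (𝔽.cring j) (𝔽.isField j) (y j) (∉-support⁻ (x∈∁p⇒x∉p j∈∁x)) (xy≈1 j)

  incomparable⇒Adj : ∀ (u v : Vertex) → Incomparable (support (proj₁ u)) (support (proj₁ v)) → Adj u v
  incomparable⇒Adj _ _ (su⊈sv , sv⊈su) =
    (λ u≈v → su⊈sv (λ {i} → subst (i ∈_) (support-cong u≈v))) , su⊈sv ∘ ∈R⇒support⊆ , sv⊈su ∘ ∈R⇒support⊆

  Adj⇒incomparable : ∀ (u v : Vertex) → Adj u v → Incomparable (support (proj₁ u)) (support (proj₁ v))
  Adj⇒incomparable _ _ (_ , u∉Rv , v∉Ru) = u∉Rv ∘ support⊆⇒∈R , v∉Ru ∘ support⊆⇒∈R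

  basis : Fin k → R
  basis j i with i ≟ j
  ... | yes _ = 𝔽.1# i
  ... | no  _ = 𝔽.0# i

  basis-off : ∀ {i j} → ¬ i ≡ j → 𝔽._≈_ i (basis j i) (𝔽.0# i)
  basis-off {i} {j} i≢j with i ≟ j
  ... | yes i≡j = ⊥-elim (i≢j i≡j)
  ... | no  _   = 𝔽.refl i

  basis-on : ∀ j → 𝔽._≈_ j (basis j j) (𝔽.1# j)
  basis-on j with j ≟ j
  ... | yes _   = 𝔽.refl j
  ... | no  j≢j = ⊥-elim (j≢j refl)

  ∈-support-basis⁻ : ∀ {i j} → i ∈ support (basis j) → i ≡ j
  ∈-support-basis⁻ {i} {j} i∈ with i ≟ j
  ... | yes i≡j = i≡j
  ... | no  i≢j = ⊥-elim (∈-support⁻ i∈ (basis-off i≢j))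

  ∈-support-basis : ∀ j → j ∈ support (basis j)
  ∈-support-basis j = ∈-support⁺ (λ eⱼ≈0 → 𝔽.0≉1 j (𝔽.trans j (𝔽.sym j eⱼ≈0) (basis-on j)))

  basisVertex : 2 ≤ k → Fin k → Vertex
  basisVertex 2≤k j with i , i≢j ← another 2≤k j =
    basis j , nonemptyProper⇒vertex ((j , ∈-support-basis j) , (i , x∉p⇒x∈∁p (i≢j ∘ ∈-support-basis⁻)))

  basis-incomparable : ∀ (u : Vertex) {j} → j ∉ support (proj₁ u) → Incomparable (support (proj₁ u)) (support (basis j))
  basis-incomparable (x , x-vertex) j∉x = su⊈ej , ej⊈su
    where
    su⊈ej : ¬ support x ⊆ support (basis _)
    su⊈ej sx⊆ej with i , i∈x ← proj₁ (vertex⇒nonemptyProper x-vertex) =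
      j∉x (subst (_∈ support x) (∈-support-basis⁻ (sx⊆ej i∈x)) i∈x)
    ej⊈su : ¬ support (basis _) ⊆ support x
    ej⊈su ej⊆sx = j∉x (ej⊆sx (∈-support-basis _))

  outside-both : ∀ (u v : Vertex) → ¬ Incomparable (support (proj₁ u)) (support (proj₁ v)) →
                 ∃ λ j → j ∉ support (proj₁ u) × j ∉ support (proj₁ v)
  outside-both (x , x-vertex) (y , y-vertex) ¬x∥y with support x ⊆? support y | support y ⊆? support x
  ... | yes sx⊆sy | _ with j , j∈∁y ← proj₂ (vertex⇒nonemptyProper y-vertex) =
    j , x∈∁p⇒x∉p j∈∁y ∘ sx⊆sy , x∈∁p⇒x∉p j∈∁y
  ... | no _ | yes sy⊆sx with j , j∈∁x ← proj₂ (vertex⇒nonemptyProper x-vertex) =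
    j , x∈∁p⇒x∉p j∈∁x , x∈∁p⇒x∉p j∈∁x ∘ sy⊆sx
  ... | no sx⊈sy | no sy⊈sx = ⊥-elim (¬x∥y (sx⊈sy , sy⊈sx))

  distance : Vertex → Vertex → ℕ
  distance u v with proj₁ u ≟ᴿ proj₁ v
  ... | yes _ = 0
  ... | no  _ = supportDistance (support (proj₁ u)) (support (proj₁ v))

  distance-walk : 2 ≤ k → ∀ u v → Walk u v (distance u v)
  distance-walk 2≤k u v with proj₁ u ≟ᴿ proj₁ v
  ... | yes u≈v = stop u≈v
  ... | no  _ with incomparable? (support (proj₁ u)) (support (proj₁ v))
  ...   | yes u∥v = step {z = v} (incomparable⇒Adj u v u∥v) (stop ≈ᴿ-refl)
  ...   | no ¬u∥v with j , j∉u , j∉v ← outside-both u v ¬u∥v =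
    step {z = e} (incomparable⇒Adj u e (basis-incomparable u j∉u))
         (step {z = v} (incomparable⇒Adj e v (swap (basis-incomparable v j∉v))) (stop ≈ᴿ-refl))
    where
    e : Vertex
    e = basisVertex 2≤k j

  distance-minimal : ∀ u v n → Walk u v n → distance u v ≤ n
  distance-minimal u v zero (stop u≈v) with proj₁ u ≟ᴿ proj₁ v
  ... | yes _   = z≤n
  ... | no  u≉v = ⊥-elim (u≉v u≈v)
  distance-minimal u v (suc zero) (step {z = w} adj (stop w≈v)) with proj₁ u ≟ᴿ proj₁ v
  ... | yes _ = z≤n
  ... | no  _ with incomparable? (support (proj₁ u)) (support (proj₁ v))
  ...   | yes _   = ≤-refl
  ...   | no ¬u∥v = ⊥-elim (¬u∥v (subst (Incomparable _) (support-cong w≈v) (Adj⇒incomparable u w adj)))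
  distance-minimal u v (suc (suc n)) _ with proj₁ u ≟ᴿ proj₁ v
  ... | yes _ = z≤n
  ... | no  _ = ≤-trans (supportDistance≤2 _ _) (s≤s (s≤s z≤n))

  distance-isDistance : 2 ≤ k → IsDistance distance
  distance-isDistance 2≤k u v = distance-walk 2≤k u v , distance-minimal u v

  candidates : ∀ {i} → Bool → List (𝔽.Carrier i)
  candidates {i} true  = others (𝔽.card i) (𝔽.0# i)
  candidates {i} false = 𝔽.0# i ∷ []

  candidates-enumerates : ∀ {i} b → Enumerates (𝔽._≈_ i) (λ a → does (nonzero? a) ≡ b) (candidates b)
  candidates-enumerates {i} true =
    Enumerates-resp (λ a → dec-true (nonzero? a)) (λ a → does-true⁻ (nonzero? a)) (others-enumerates (𝔽.card i) (𝔽.0# i))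
  candidates-enumerates {i} false = record
    { sound    = dec-false (nonzero? (𝔽.0# i)) (λ 0≉0 → 0≉0 (𝔽.refl i)) ∷ []
    ; complete = λ a zero-bit → here (decidable-stable (a ≟ᵢ 𝔽.0# i) (does-false⁻ (nonzero? a) zero-bit))
    ; distinct = [] ∷ []
    }

  length-candidates : ∀ {i} b → length (candidates {i} b) ≡ (if b then q i ∸ 1 else 1)
  length-candidates {i} true  = length-others (𝔽.card i) (𝔽.0# i)
  length-candidates {i} false = refl

  fibre : Subset k → List R
  fibre A = choices (λ i → candidates (Vec.lookup A i))

  fibre-enumerates : ∀ A → Enumerates _≈ᴿ_ (λ x → support x ≡ A) (fibre A)
  fibre-enumerates A = Enumerates-resp
    (λ x bits → trans (tabulate-cong bits) (tabulate∘lookup A))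
    (λ x sx≡A i → trans (sym (lookup∘tabulate _ i)) (cong (λ B → Vec.lookup B i) sx≡A))
    (choices-enumerates (λ i → 𝔽._≈_ i) _ (λ i → candidates-enumerates (Vec.lookup A i)))

  length-fibre : ∀ A → length (fibre A) ≡ m q A
  length-fibre A = trans (length-choices (λ i → candidates (Vec.lookup A i))) (cong product (begin
    tabulate (λ i → length (candidates (Vec.lookup A i)))
      ≡⟨ List-tabulate-cong (λ i → length-candidates (Vec.lookup A i)) ⟩
    tabulate (λ i → if Vec.lookup A i then q i ∸ 1 else 1)
      ≡⟨ map-tabulate id _ ⟨
    map (λ i → if Vec.lookup A i then q i ∸ 1 else 1) (allFin k) ∎))
    where open ≡-Reasoning

  proj₁-enumerates : ∀ {vs} → IsEnumeration vs → Enumerates _≈ᴿ_ (IsNonemptyProper ∘ support) (map proj₁ vs)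
  proj₁-enumerates (complete-vs , distinct-vs) = record
    { sound    = AllP.map⁺ (All.tabulate (λ {u} _ → vertex⇒nonemptyProper (proj₂ u)))
    ; complete = λ x sx-nonemptyProper → AnyP.map⁺ (complete-vs (x , nonemptyProper⇒vertex sx-nonemptyProper))
    ; distinct = APP.map⁺ distinct-vs
    }

  enumeration-support-sum : ∀ {vs} → IsEnumeration vs → (h : Subset k → ℕ) →
                            sum (map (h ∘ support ∘ proj₁) vs) ≡ sum (map (λ A → m q A * h A) (𝒫 k))
  enumeration-support-sum {vs} vs-enum h = begin
    sum (map (h ∘ support ∘ proj₁) vs)
      ≡⟨ cong sum (map-∘ vs) ⟩
    sum (map (h ∘ support) (map proj₁ vs))
      ≡⟨ enumeration-fibre-sum support support-cong (𝒫-enumerates k) fibre fibre-enumerates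
                               ≈ᴿ-isEquivalence (proj₁-enumerates vs-enum) h ⟩
    sum (map (λ A → length (fibre A) * h A) (𝒫 k))
      ≡⟨ cong sum (map-cong (λ A → cong (_* h A) (length-fibre A)) (𝒫 k)) ⟩
    sum (map (λ A → m q A * h A) (𝒫 k)) ∎
    where open ≡-Reasoning

  distance-apart : ∀ {u v} → ¬ u ≈V v → distance u v ≡ supportDistance (support (proj₁ u)) (support (proj₁ v))
  distance-apart {u} {v} u≉v with proj₁ u ≟ᴿ proj₁ v
  ... | yes u≈v = ⊥-elim (u≉v u≈v)
  ... | no  _   = refl

  pairSum-distance : ∀ {vs} → IsEnumeration vs → pairSum distance vs ≡ wienerFormula k q
  pairSum-distance {vs} vs-enum = *-cancelˡ-≡ _ _ 2 (+-cancelʳ-≡ D _ _ (begin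
    2 * pairSum distance vs + D
      ≡⟨ cong (λ t → 2 * t + D) (pairSum-cong distance-apart (proj₂ vs-enum)) ⟩
    2 * pairSum (λ u v → supportDistance (support (proj₁ u)) (support (proj₁ v))) vs + D
      ≡⟨ pairSum-fibres (support ∘ proj₁) (m q) vs (𝒫 k) (enumeration-support-sum vs-enum)
                        supportDistance supportDistance-sym ⟩
    2 * pairSum (weightedDistance k q) (𝒫 k) + sum (map (λ A → m q A * m q A * supportDistance A A) (𝒫 k))
      ≡⟨ wienerFormula-doubled k q ⟨
    2 * wienerFormula k q + D ∎))
    where
    open ≡-Reasoning
    D : ℕ
    D = sum (map (λ A → m q A * supportDistance A A) (𝒫 k))

theorem4p2 : (k : ℕ) → 2 ≤ k → (q : Fin k → ℕ) →
    (F : (i : Fin k) → FiniteField (q i)) →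
    IsWienerIndex (Product._≈V_ F) (Product.Adj F) (wienerFormula k q)
theorem4p2 k 2≤k q F = distance , distance-isDistance 2≤k , λ vs → pairSum-distance
  where open CozeroDivisorGraph F
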